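{- Let $(G,c,k)$ be an instance of \textsc{Multi-STC} and let $A\subseteq\mathscr{P}$ be a periphery component such that there exists a vertex $v\in A$ with $\deg_G(v)<\lfloor c/2\rfloor+1$. Then $A$ is good.
   Context: A $c$-colored labeling of $G=(V,E)$ is a partition $L=(S^1_L,\dots,S^c_L,W_L)$ of $E$; it is an STC-labeling if there are no $\{u,v\},\{v,w\}\in S^i_L$ ($u\ne w$) with $\{u,w\}\notin E$. Fix $D\subseteq E$ such that $(V,E\setminus D)$ has maximum degree at most $\lfloor c/2\rfloor+1$; the core $\mathscr{C}$ is the set of vertices incident with an edge of $D$, $\mathscr{P}=V\setminus\mathscr{C}$, and a periphery component is the vertex set of a connected component of $G[\mathscr{P}]$. $E(A)$ denotes edges with both endpoints in $A$. Labelings $L,L'$ are partially equal on $E'$ if for all $e\in E'$ and all $i$, $e\in S^i_L\iff e\in S^i_{L'}$. A periphery component $A$ is good if for every STC-labeling $L$ of $G$ with $E(A)\subseteq W_L$ there is an STC-labeling $L'$ partially equal to $L$ on $E\setminus E(A)$ with $W_{L'}\cap E(A)=\emptyset$. -}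

module Defs where

open import Data.Nat using (ℕ; zero; suc; _+_; _≤_; _<_; ⌊_/2⌋)
open import Data.Fin using (Fin)
open import Data.Bool using (Bool; true; false; if_then_else_)
open import Data.Maybe using (Maybe; just; nothing)
open import Data.List using (List; map; allFin)
open import Data.Nat.ListAction using (sum)
open import Data.Product using (Σ; ∃; _×_; _,_)
open import Relation.Nullary using (¬_)
open import Relation.Binary.PropositionalEquality using (_≡_; _≢_)
open import Function.Bundles using (_⇔_)

record Graph (n : ℕ) : Set where
  field
    adj   : Fin n → Fin n → Bool
    sym   : ∀ u v → adj u v ≡ adj v u
    irrfl : ∀ v → adj v v ≡ false
open Graph public

Edge : ∀ {n} → Graph n → Fin n → Fin n → Set
Edge G u v = adj G u v ≡ true

deg : ∀ {n} → Graph n → Fin n → ℕ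
deg G v = sum (map (λ w → if adj G v w then 1 else 0) (allFin _))

-- A c-colored labeling: each edge gets a label in Maybe (Fin c);
-- just i means the edge is in S^(i+1), nothing means it is in W.
-- Values on non-edges are irrelevant; on edges the label is symmetric
-- (edges are unordered pairs).
record Labeling {n : ℕ} (G : Graph n) (c : ℕ) : Set where
  field
    lab    : Fin n → Fin n → Maybe (Fin c)
    labSym : ∀ u v → Edge G u v → lab u v ≡ lab v u
open Labeling public

IsSTC : ∀ {n c} {G : Graph n} → Labeling G c → Set
IsSTC {n} {c} {G} L =
  ∀ (u v w : Fin n) (i : Fin c) → u ≢ w →
    Edge G u v → Edge G v w →
    lab L u v ≡ just i → lab L v w ≡ just i →
    Edge G u w

record EdgeSubset {n : ℕ} (G : Graph n) : Set where
  field
    inD   : Fin n → Fin n → Bool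
    inDsym : ∀ u v → inD u v ≡ inD v u
    inD⊆E : ∀ u v → inD u v ≡ true → Edge G u v
open EdgeSubset public

degMinus : ∀ {n} (G : Graph n) → EdgeSubset G → Fin n → ℕ
degMinus G D v =
  sum (map (λ w → if adj G v w then (if inD D v w then 0 else 1) else 0) (allFin _))

AdmissibleD : ∀ {n} (G : Graph n) → ℕ → EdgeSubset G → Set
AdmissibleD G c D = ∀ v → degMinus G D v ≤ ⌊ c /2⌋ + 1

InCore : ∀ {n} {G : Graph n} → EdgeSubset G → Fin n → Set
InCore D v = ∃ λ w → inD D v w ≡ true

InPeriphery : ∀ {n} {G : Graph n} → EdgeSubset G → Fin n → Set
InPeriphery D v = ¬ InCore D v

data ReachP {n} (G : Graph n) (D : EdgeSubset G) : Fin n → Fin n → Set where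
  here : ∀ {x} → InPeriphery D x → ReachP G D x x
  step : ∀ {x y z} → ReachP G D x y → Edge G y z → InPeriphery D z → ReachP G D x z

IsPeripheryComponent : ∀ {n} (G : Graph n) → EdgeSubset G → (Fin n → Set) → Set
IsPeripheryComponent {n} G D A =
  Σ (Fin n) λ a → A a × InPeriphery D a × (∀ x → A x ⇔ ReachP G D a x)

InEA : ∀ {n} → (Fin n → Set) → Fin n → Fin n → Set
InEA A u v = A u × A v

PartiallyEqualOutside : ∀ {n c} {G : Graph n} → (Fin n → Set) →
  Labeling G c → Labeling G c → Set
PartiallyEqualOutside {n} {c} {G} A L L' =
  ∀ u v → Edge G u v → ¬ InEA A u v → lab L u v ≡ lab L' u v

Good : ∀ {n} (G : Graph n) (c : ℕ) → (Fin n → Set) → Set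
Good {n} G c A =
  ∀ (L : Labeling G c) → IsSTC L →
    (∀ u v → Edge G u v → InEA A u v → lab L u v ≡ nothing) →
    Σ (Labeling G c) λ L' → IsSTC L' × PartiallyEqualOutside A L L' ×
      (∀ u v → Edge G u v → InEA A u v → lab L' u v ≢ nothing)

module Submission where

-- Vertices of A have no
-- D-edges, so they have degree at most ⌊c/2⌋ + 1.  Number the vertices of A
-- by their breadth-first distance from v inside G[𝒫] and give each edge of
-- E(A) the level "distance of its nearer end".  Colour the edges of E(A)
-- one at a time, higher levels first.  When zo is coloured (z nearer to v),
-- either z = v, or the edge from z to its BFS parent has a lower level and is
-- still weak; either way z sees at most ⌊c/2⌋ - 1 colours on its other
-- edges, o sees at most ⌊c/2⌋, so one of the c colours is free at both ends
-- and putting zo into that class keeps strong triadic closure.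

open import Defs hiding (sym)
open import Data.Nat using (ℕ; zero; suc; _+_; _≤_; _<_; z≤n; s≤s; ⌊_/2⌋; ⌈_/2⌉; _⊓_) renaming (_≟_ to _≟ℕ_)
open import Data.Nat.Properties hiding (_≟_)
open import Data.Fin using (Fin; _≟_)
open import Data.Fin.Properties using (all?; any?; ¬∀⟶∃¬; pigeonhole) renaming (<⇒≢ to <⇒≢ᶠ)
open import Data.Bool using (Bool; true; false; if_then_else_; _∧_; not) renaming (_≟_ to _≡?_)
open import Data.Maybe using (Maybe; just; nothing; is-just)
open import Data.List using (List; []; _∷_; map; allFin; length; _++_; mapMaybe; cartesianProduct)
open import Data.List.Membership.Propositional using (_∈_; _∉_)
open import Data.List.Membership.Propositional.Properties using (∈-allFin; ∈-++⁺ˡ; ∈-++⁺ʳ; ∈-cartesianProduct⁺)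
import Data.List.Membership.DecPropositional as DecMembership
open import Data.List.Properties using (length-++; length-tabulate)
open import Data.List.Relation.Unary.Any using (here; there; index)
open import Data.List.Relation.Unary.Any.Properties using (lookup-index)
open import Data.List as List using ()
open import Data.Nat.ListAction using (sum)
open import Data.Product using (Σ; ∃; _×_; _,_; proj₁; proj₂)
open import Data.Sum using (_⊎_; inj₁; inj₂)
open import Data.Empty using (⊥; ⊥-elim)
open import Function using (_∘_; id)
open import Relation.Nullary using (¬_; Dec; yes; no; does)
open import Relation.Nullary.Decidable using (¬?; _×-dec_; _⊎-dec_; _→-dec_)
open import Relation.Binary.PropositionalEquality
open import Function.Bundles using (_⇔_; mk⇔; Equivalence)
open import Function.Properties.Equivalence using () renaming (sym to ⇔-sym)
open Equivalence using (to; from)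
import Relation.Nullary.Decidable as Dec

indicator : Bool → ℕ
indicator b = if b then 1 else 0

indicator≤1 : ∀ b → indicator b ≤ 1
indicator≤1 true = ≤-refl
indicator≤1 false = z≤n

sum-mono : ∀ {a} {X : Set a} (f g : X → ℕ) → (∀ x → f x ≤ g x) → (xs : List X) →
  sum (map f xs) ≤ sum (map g xs)
sum-mono f g f≤g [] = z≤n
sum-mono f g f≤g (x ∷ xs) = +-mono-≤ (f≤g x) (sum-mono f g f≤g xs)

sum-mono-< : ∀ {a} {X : Set a} (f g : X → ℕ) → (∀ x → f x ≤ g x) →
  ∀ {y} (xs : List X) → y ∈ xs → f y < g y → sum (map f xs) < sum (map g xs)
sum-mono-< f g f≤g (x ∷ xs) (here refl) fy<gy = +-mono-<-≤ fy<gy (sum-mono f g f≤g xs)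
sum-mono-< f g f≤g (x ∷ xs) (there y∈xs) fy<gy = +-mono-≤-< (f≤g x) (sum-mono-< f g f≤g xs y∈xs fy<gy)

_∈?_ : ∀ {c} (i : Fin c) (xs : List (Fin c)) → Dec (i ∈ xs)
_∈?_ = DecMembership._∈?_ _≟_

-- A list of fewer than c colours misses some colour (pigeonhole principle:
-- otherwise "position of i in the list" would inject Fin c into a smaller Fin).
missing-colour : ∀ {c} (xs : List (Fin c)) → length xs < c → ∃ λ i → i ∉ xs
missing-colour {c} xs short with all? (_∈? xs)
... | no notAll = ¬∀⟶∃¬ c _ (_∈? xs) notAll
... | yes allIn with pigeonhole short (λ i → index (allIn i))
... | i , j , i<j , samePos = ⊥-elim (<⇒≢ᶠ i<j (begin
  i                                ≡⟨ lookup-index (allIn i) ⟩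
  List.lookup xs (index (allIn i)) ≡⟨ cong (List.lookup xs) samePos ⟩
  List.lookup xs (index (allIn j)) ≡⟨ sym (lookup-index (allIn j)) ⟩
  j                                ∎))
  where open ≡-Reasoning

length-mapMaybe : ∀ {a b} {X : Set a} {Y : Set b} (f : X → Maybe Y) (xs : List X) →
  length (mapMaybe f xs) ≡ sum (map (λ x → indicator (is-just (f x))) xs)
length-mapMaybe f [] = refl
length-mapMaybe f (x ∷ xs) with f x
... | just _ = cong suc (length-mapMaybe f xs)
... | nothing = length-mapMaybe f xs

∈-mapMaybe : ∀ {a b} {X : Set a} {Y : Set b} (f : X → Maybe Y) {x y} (xs : List X) →
  x ∈ xs → f x ≡ just y → y ∈ mapMaybe f xs
∈-mapMaybe f (x ∷ xs) (here refl) fx≡y with f x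
∈-mapMaybe f (x ∷ xs) (here refl) refl | just _ = here refl
∈-mapMaybe f (x ∷ xs) (there x∈xs) fx≡y with f x
... | just _ = there (∈-mapMaybe f xs x∈xs fx≡y)
... | nothing = ∈-mapMaybe f xs x∈xs fx≡y

edge-sym : ∀ {n} (G : Graph n) {x y} → Edge G x y → Edge G y x
edge-sym G {x} {y} xy = trans (Graph.sym G y x) xy

otherNeighbour : ∀ {n} → Graph n → Fin n → Fin n → Fin n → Bool
otherNeighbour G x y w = adj G x w ∧ not (does (w ≟ y))

degExcept : ∀ {n} → Graph n → Fin n → Fin n → ℕ
degExcept G x y = sum (map (λ w → indicator (otherNeighbour G x y w)) (allFin _))

otherNeighbour-intro : ∀ {n} (G : Graph n) {x y w} → Edge G x w → w ≢ y →
  otherNeighbour G x y w ≡ true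
otherNeighbour-intro G {y = y} {w} xw w≢y rewrite xw with w ≟ y
... | yes w≡y = ⊥-elim (w≢y w≡y)
... | no _ = refl

degExcept<deg : ∀ {n} (G : Graph n) {x y} → Edge G x y → degExcept G x y < deg G x
degExcept<deg {n} G {x} {y} xy =
  sum-mono-< _ _ excluded≤ (allFin n) (∈-allFin y) y-excluded
  where
  excluded≤ : ∀ w → indicator (otherNeighbour G x y w) ≤ indicator (adj G x w)
  excluded≤ w with adj G x w
  ... | true = indicator≤1 _
  ... | false = z≤n
  y-excluded : indicator (otherNeighbour G x y y) < indicator (adj G x y)
  y-excluded rewrite xy with y ≟ y
  ... | yes _ = s≤s z≤n
  ... | no y≢y = ⊥-elim (y≢y refl)

-- The colours of the edges xw with w ≠ y under a labeling M: a colour given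
-- to the edge xy must avoid them.
module _ {n} {G : Graph n} {c} (M : Labeling G c) where

  colourAt : Fin n → Fin n → Fin n → Maybe (Fin c)
  colourAt x y w = if otherNeighbour G x y w then lab M x w else nothing

  seen : Fin n → Fin n → List (Fin c)
  seen x y = mapMaybe (colourAt x y) (allFin n)

  ∈-seen : ∀ {x y w i} → Edge G x w → w ≢ y → lab M x w ≡ just i → i ∈ seen x y
  ∈-seen {x} {y} {w} xw w≢y xw≡i = ∈-mapMaybe (colourAt x y) (allFin n) (∈-allFin w)
    (subst (λ b → (if b then lab M x w else nothing) ≡ _) (sym (otherNeighbour-intro G xw w≢y)) xw≡i)

  private
    coloured≤other : ∀ x y w →
      indicator (is-just (colourAt x y w)) ≤ indicator (otherNeighbour G x y w)
    coloured≤other x y w with otherNeighbour G x y w | lab M x w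
    ... | true | just _ = ≤-refl
    ... | true | nothing = z≤n
    ... | false | _ = z≤n

  -- Each seen colour comes from a distinct edge at x other than xy ...
  seen-length≤ : ∀ x y → length (seen x y) ≤ degExcept G x y
  seen-length≤ x y = begin
    length (seen x y) ≡⟨ length-mapMaybe (colourAt x y) (allFin n) ⟩
    _                 ≤⟨ sum-mono _ _ (coloured≤other x y) (allFin n) ⟩
    degExcept G x y   ∎
    where open ≤-Reasoning

  -- ... and an uncoloured edge xp with p ≠ y contributes no colour.
  seen-length< : ∀ {x y p} → Edge G x p → p ≢ y → lab M x p ≡ nothing →
    length (seen x y) < degExcept G x y
  seen-length< {x} {y} {p} xp p≢y xp-weak = begin-strict
    length (seen x y) ≡⟨ length-mapMaybe (colourAt x y) (allFin n) ⟩
    _                 <⟨ sum-mono-< _ _ (coloured≤other x y) (allFin n) (∈-allFin p) p-uncoloured ⟩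
    degExcept G x y   ∎
    where
    open ≤-Reasoning
    p-uncoloured : indicator (is-just (colourAt x y p)) < indicator (otherNeighbour G x y p)
    p-uncoloured rewrite otherNeighbour-intro G xp p≢y | xp-weak = s≤s z≤n

Endpoints : ∀ {n} → Fin n → Fin n → Fin n → Fin n → Set
Endpoints z o u w = (u ≡ z × w ≡ o) ⊎ (u ≡ o × w ≡ z)

endpoints? : ∀ {n} (z o u w : Fin n) → Dec (Endpoints z o u w)
endpoints? z o u w = (u ≟ z ×-dec w ≟ o) ⊎-dec (u ≟ o ×-dec w ≟ z)

endpoints-swap : ∀ {n} {z o u w : Fin n} → Endpoints z o u w → Endpoints z o w u
endpoints-swap (inj₁ (u≡z , w≡o)) = inj₂ (w≡o , u≡z)
endpoints-swap (inj₂ (u≡o , w≡z)) = inj₁ (w≡z , u≡o)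

Unused : ∀ {n} {G : Graph n} {c} → Labeling G c → Fin c → Fin n → Fin n → Set
Unused {G = G} M i x y = ∀ w → Edge G x w → w ≢ y → lab M x w ≢ just i

module _ {n} {G : Graph n} {c} (M : Labeling G c) (z o : Fin n) (i : Fin c) where

  relabel : Labeling G c
  relabel = record { lab = newLab ; labSym = newLab-sym }
    where
    newLab : Fin n → Fin n → Maybe (Fin c)
    newLab u w with endpoints? z o u w
    ... | yes _ = just i
    ... | no _ = lab M u w
    newLab-sym : ∀ u w → Edge G u w → newLab u w ≡ newLab w u
    newLab-sym u w uw with endpoints? z o u w | endpoints? z o w u
    ... | yes _ | yes _ = refl
    ... | no _ | no _ = labSym M u w uw
    ... | yes e | no ¬e = ⊥-elim (¬e (endpoints-swap e))
    ... | no ¬e | yes e = ⊥-elim (¬e (endpoints-swap e))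

  relabel-on : ∀ {u w} → Endpoints z o u w → lab relabel u w ≡ just i
  relabel-on {u} {w} e with endpoints? z o u w
  ... | yes _ = refl
  ... | no ¬e = ⊥-elim (¬e e)

  relabel-cases : ∀ u w → lab relabel u w ≡ just i ⊎ lab relabel u w ≡ lab M u w
  relabel-cases u w with endpoints? z o u w
  ... | yes _ = inj₁ refl
  ... | no _ = inj₂ refl

  relabel-off : ∀ {u w} → ¬ Endpoints z o u w → lab relabel u w ≡ lab M u w
  relabel-off {u} {w} ¬e with endpoints? z o u w
  ... | yes e = ⊥-elim (¬e e)
  ... | no _ = refl

  -- Strong triadic closure survives if colour i is unused at both ends of
  -- {z,o}: a new violating wedge would need a second i-edge at z or at o.
  relabel-STC : IsSTC M → Unused M i z o → Unused M i o z → IsSTC relabel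
  relabel-STC stc free-z free-o u v w j u≢w uv vw uv≡j vw≡j
    with endpoints? z o u v | endpoints? z o v w
  ... | no ¬e₁ | no ¬e₂ =
    stc u v w j u≢w uv vw uv≡j vw≡j
  ... | yes e₁ | no ¬e₂ = ⊥-elim (wedge-at-v e₁ (trans vw≡j (sym uv≡j)))
    where
    wedge-at-v : Endpoints z o u v → lab M v w ≢ just i
    wedge-at-v (inj₁ (refl , refl)) = free-o w vw (u≢w ∘ sym)
    wedge-at-v (inj₂ (refl , refl)) = free-z w vw (u≢w ∘ sym)
  ... | no ¬e₁ | yes e₂ = ⊥-elim (wedge-at-v e₂ vu≡i)
    where
    vu : Edge G v u
    vu = edge-sym G uv
    vu≡i : lab M v u ≡ just i
    vu≡i = trans (labSym M v u vu) (trans uv≡j (sym vw≡j))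
    wedge-at-v : Endpoints z o v w → lab M v u ≢ just i
    wedge-at-v (inj₁ (refl , refl)) = free-z u vu u≢w
    wedge-at-v (inj₂ (refl , refl)) = free-o u vu u≢w
  ... | yes e₁ | yes e₂ = ⊥-elim (same-pair e₁ e₂)
    where
    no-loop : ∀ {x} → ¬ Edge G x x
    no-loop {x} xx with trans (sym xx) (irrfl G x)
    ... | ()
    same-pair : Endpoints z o u v → Endpoints z o v w → ⊥
    same-pair (inj₁ (refl , refl)) (inj₁ (refl , _)) = no-loop uv
    same-pair (inj₁ (refl , refl)) (inj₂ (_ , refl)) = u≢w refl
    same-pair (inj₂ (refl , refl)) (inj₁ (_ , refl)) = u≢w refl
    same-pair (inj₂ (refl , refl)) (inj₂ (refl , _)) = no-loop uv

colour-edge : ∀ {n} {G : Graph n} {c} (M : Labeling G c) → IsSTC M → ∀ z o →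
  length (seen M z o) + length (seen M o z) < c → ∃ λ i → IsSTC (relabel M z o i)
colour-edge M stc z o few with missing-colour (seen M z o ++ seen M o z)
                                               (subst (_< _) (sym (length-++ (seen M z o))) few)
... | i , i∉ = i , relabel-STC M z o i stc unused-z unused-o
  where
  unused-z : Unused M i z o
  unused-z w zw w≢o zw≡i = i∉ (∈-++⁺ˡ (∈-seen M zw w≢o zw≡i))
  unused-o : Unused M i o z
  unused-o w ow w≢z ow≡i = i∉ (∈-++⁺ʳ (seen M z o) (∈-seen M ow w≢z ow≡i))

_⊆ᵇ_ : ∀ {n} → (Fin n → Bool) → (Fin n → Bool) → Set
S ⊆ᵇ T = ∀ z → S z ≡ true → T z ≡ true

size : ∀ {n} → (Fin n → Bool) → ℕ
size {n} S = sum (map (λ z → indicator (S z)) (allFin n))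

size≤n : ∀ {n} (S : Fin n → Bool) → size S ≤ n
size≤n {n} S = begin
  size S                            ≤⟨ sum-mono _ (λ _ → 1) (λ z → indicator≤1 (S z)) (allFin n) ⟩
  sum (map (λ _ → 1) (allFin n))    ≡⟨ sum-ones (allFin n) ⟩
  length (allFin n)                 ≡⟨ length-tabulate (λ z → z) ⟩
  n                                 ∎
  where
  open ≤-Reasoning
  sum-ones : ∀ {a} {X : Set a} (xs : List X) → sum (map (λ _ → 1) xs) ≡ length xs
  sum-ones [] = refl
  sum-ones (x ∷ xs) = cong suc (sum-ones xs)

newly-added : ∀ {a b : Bool} → ¬ (b ≡ true → a ≡ true) → a ≡ false × b ≡ true
newly-added {true} changed = ⊥-elim (changed (λ _ → refl))
newly-added {false} {true} _ = refl , refl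
newly-added {false} {false} changed = ⊥-elim (changed (λ ()))

size-< : ∀ {n} {S T : Fin n → Bool} → S ⊆ᵇ T → ∀ z → S z ≡ false → T z ≡ true →
  size S < size T
size-< {n} {S} {T} S⊆T z Sz Tz = sum-mono-< _ _ pointwise (allFin n) (∈-allFin z) at-z
  where
  pointwise : ∀ w → indicator (S w) ≤ indicator (T w)
  pointwise w with S w in Sw
  ... | true rewrite S⊆T w Sw = ≤-refl
  ... | false = z≤n
  at-z : indicator (S z) < indicator (T z)
  at-z rewrite Sz | Tz = s≤s z≤n

-- Saturation: iterating a monotone, inflationary operator F on subsets of
-- Fin n from any start S₀ reaches its final value after n steps, since every
-- step that changes the set enlarges it and sizes are bounded by n.
module Saturation {n} (F : (Fin n → Bool) → Fin n → Bool)
  (F-mono : ∀ {S T} → S ⊆ᵇ T → F S ⊆ᵇ F T)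
  (F-inflationary : ∀ S → S ⊆ᵇ F S)
  (S₀ : Fin n → Bool) where

  iterate : ℕ → Fin n → Bool
  iterate zero = S₀
  iterate (suc k) = F (iterate k)

  iterate-mono : ∀ {j k} → j ≤ k → iterate j ⊆ᵇ iterate k
  iterate-mono {k = zero} z≤n z = id
  iterate-mono {j} {suc k} j≤1+k z with m≤n⇒m<n∨m≡n j≤1+k
  ... | inj₁ (s≤s j≤k) = F-inflationary (iterate k) z ∘ iterate-mono j≤k z
  ... | inj₂ refl = id

  Stable : ℕ → Set
  Stable j = iterate (suc j) ⊆ᵇ iterate j

  stable-from : ∀ {j k} → Stable j → j ≤ k → iterate k ⊆ᵇ iterate j
  stable-from {k = zero} st z≤n z = id
  stable-from {j} {suc k} st j≤1+k z with m≤n⇒m<n∨m≡n j≤1+k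
  ... | inj₁ (s≤s j≤k) = st z ∘ F-mono (stable-from st j≤k) z
  ... | inj₂ refl = id

  unchanged? : ∀ k z → Dec (iterate (suc k) z ≡ true → iterate k z ≡ true)
  unchanged? k z = iterate (suc k) z ≡? true →-dec iterate k z ≡? true

  growth : ∀ k → (∃ λ j → j < k × Stable j) ⊎ k ≤ size (iterate k)
  growth zero = inj₂ z≤n
  growth (suc k) with growth k
  ... | inj₁ (j , j<k , st) = inj₁ (j , m≤n⇒m≤1+n j<k , st)
  ... | inj₂ k≤size with all? (unchanged? k)
  ...   | yes st = inj₁ (k , ≤-refl , st)
  ...   | no ¬st with ¬∀⟶∃¬ n _ (unchanged? k) ¬st
  ...     | z , changed with newly-added changed
  ...       | old-false , new-true =
    inj₂ (≤-trans (s≤s k≤size) (size-< (F-inflationary (iterate k)) z old-false new-true))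

  stabilises : ∃ λ j → j ≤ n × Stable j
  stabilises with growth (suc n)
  ... | inj₁ (j , s≤s j≤n , st) = j , j≤n , st
  ... | inj₂ n<size = ⊥-elim (<-irrefl refl (≤-trans n<size (size≤n (iterate (suc n)))))

  saturated : ∀ k → iterate k ⊆ᵇ iterate n
  saturated k z with stabilises
  ... | j , j≤n , st = iterate-mono j≤n z ∘ stable-from st (≤-trans j≤n (m≤n+m n k)) z
                         ∘ iterate-mono (m≤m+n k n) z

-- The least k ≤ N with P k ≡ true (or N when there is none).
least : (ℕ → Bool) → ℕ → ℕ
least P zero = zero
least P (suc N) = if P zero then zero else suc (least (P ∘ suc) N)

least≤ : ∀ (P : ℕ → Bool) N → least P N ≤ N
least≤ P zero = z≤n
least≤ P (suc N) with P zero
... | true = z≤n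
... | false = s≤s (least≤ (P ∘ suc) N)

least-sat : ∀ (P : ℕ → Bool) N {k} → P k ≡ true → k ≤ N → P (least P N) ≡ true
least-sat P zero Pk z≤n = Pk
least-sat P (suc N) {zero} Pk _ rewrite Pk = Pk
least-sat P (suc N) {suc k} Pk (s≤s k≤N) with P zero in P0
... | true = P0
... | false = least-sat (P ∘ suc) N Pk k≤N

least-min : ∀ (P : ℕ → Bool) N {k} → P k ≡ true → least P N ≤ k
least-min P zero Pk = z≤n
least-min P (suc N) {zero} Pk rewrite Pk = z≤n
least-min P (suc N) {suc k} Pk with P zero
... | true = z≤n
... | false = s≤s (least-min (P ∘ suc) N Pk)

reach-end : ∀ {n} {G : Graph n} {D : EdgeSubset G} {x y} → ReachP G D x y → InPeriphery D y
reach-end (here py) = py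
reach-end (step _ _ py) = py

reach-trans : ∀ {n} {G : Graph n} {D : EdgeSubset G} {x y z} →
  ReachP G D x y → ReachP G D y z → ReachP G D x z
reach-trans r (here _) = r
reach-trans r (step s yz pz) = step (reach-trans r s) yz pz

reach-sym : ∀ {n} {G : Graph n} {D : EdgeSubset G} {x y} → ReachP G D x y → ReachP G D y x
reach-sym (here px) = here px
reach-sym {G = G} (step r yz pz) = reach-trans (step (here pz) (edge-sym G yz) (reach-end r)) (reach-sym r)

-- Breadth-first search in G[𝒫] from a periphery vertex v: layer k is the set
-- of vertices reachable from v inside G[𝒫] by a path with at most k edges.
module Layers {n} (G : Graph n) (D : EdgeSubset G) (v : Fin n) (pv : InPeriphery D v) where

  periphery? : ∀ z → Dec (InPeriphery D z)
  periphery? z = ¬? (any? λ w → inD D z w ≡? true)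

  Joins : (Fin n → Bool) → Fin n → Set
  Joins S z = InPeriphery D z × ∃ λ w → S w ≡ true × Edge G w z

  joins? : ∀ S z → Dec (Joins S z)
  joins? S z = periphery? z ×-dec any? (λ w → S w ≡? true ×-dec adj G w z ≡? true)

  grow : (Fin n → Bool) → Fin n → Bool
  grow S z with S z | joins? S z
  ... | true | _ = true
  ... | false | yes _ = true
  ... | false | no _ = false

  grow-elim : ∀ S z → grow S z ≡ true → S z ≡ true ⊎ Joins S z
  grow-elim S z _ with S z | joins? S z
  ... | true | _ = inj₁ refl
  ... | false | yes j = inj₂ j

  grow-joins : ∀ S z → Joins S z → grow S z ≡ true
  grow-joins S z j with S z | joins? S z
  ... | true | _ = refl
  ... | false | yes _ = refl
  ... | false | no ¬j = ⊥-elim (¬j j)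

  grow-inflationary : ∀ S → S ⊆ᵇ grow S
  grow-inflationary S z Sz with S z | joins? S z
  ... | true | _ = refl

  grow-mono : ∀ {S T} → S ⊆ᵇ T → grow S ⊆ᵇ grow T
  grow-mono {S} {T} S⊆T z gS with grow-elim S z gS
  ... | inj₁ Sz = grow-inflationary T z (S⊆T z Sz)
  ... | inj₂ (pz , w , Sw , wz) = grow-joins T z (pz , w , S⊆T w Sw , wz)

  open Saturation grow grow-mono grow-inflationary (λ z → does (z ≟ v))
    using (saturated) renaming (iterate to layer) public

  layer-sound : ∀ k {z} → layer k z ≡ true → ReachP G D v z
  layer-sound zero {z} vz with z ≟ v
  ... | yes refl = here pv
  layer-sound (suc k) {z} z∈ with grow-elim (layer k) z z∈
  ... | inj₁ z∈k = layer-sound k z∈k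
  ... | inj₂ (pz , w , w∈k , wz) = step (layer-sound k w∈k) wz pz

  layer-complete : ∀ {z} → ReachP G D v z → layer n z ≡ true
  layer-complete r = saturated (depth r) _ (within r)
    where
    depth : ∀ {z} → ReachP G D v z → ℕ
    depth (here _) = zero
    depth (step r _ _) = suc (depth r)
    within : ∀ {z} (r : ReachP G D v z) → layer (depth r) z ≡ true
    within (here _) with v ≟ v
    ... | yes _ = refl
    ... | no v≢v = ⊥-elim (v≢v refl)
    within (step {y = y} {z = z} r yz pz) = grow-joins (layer (depth r)) z (pz , y , within r , yz)

periphery-deg : ∀ {n} (G : Graph n) (D : EdgeSubset G) {z} → InPeriphery D z →
  deg G z ≤ degMinus G D z
periphery-deg {n} G D {z} pz = sum-mono _ _ pointwise (allFin n)
  where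
  pointwise : ∀ w → indicator (adj G z w) ≤ (if adj G z w then (if inD D z w then 0 else 1) else 0)
  pointwise w with adj G z w
  ... | false = z≤n
  ... | true with inD D z w in zw
  ...   | false = ≤-refl
  ...   | true = ⊥-elim (pz (w , zw))

module Distance {n} (G : Graph n) (D : EdgeSubset G) (A : Fin n → Set)
  (component : IsPeripheryComponent G D A) (v : Fin n) (v∈A : A v) where

  private
    a = proj₁ component
    A⇔reach-a : ∀ x → A x ⇔ ReachP G D a x
    A⇔reach-a = proj₂ (proj₂ (proj₂ component))

  A⇔reach : ∀ {z} → A z ⇔ ReachP G D v z
  A⇔reach {z} = mk⇔
    (λ z∈A → reach-trans (reach-sym (to (A⇔reach-a v) v∈A)) (to (A⇔reach-a z) z∈A))
    (λ r → from (A⇔reach-a z) (reach-trans (to (A⇔reach-a v) v∈A) r))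

  A⊆periphery : ∀ {z} → A z → InPeriphery D z
  A⊆periphery z∈A = reach-end (to A⇔reach z∈A)

  open Layers G D v (A⊆periphery v∈A)

  A⇔layer : ∀ {z} → A z ⇔ layer n z ≡ true
  A⇔layer {z} = mk⇔ (layer-complete ∘ to A⇔reach) (from A⇔reach ∘ layer-sound n)

  A? : ∀ z → Dec (A z)
  A? z = Dec.map (⇔-sym A⇔layer) (layer n z ≡? true)

  dist : Fin n → ℕ
  dist z = least (λ k → layer k z) n

  dist≤n : ∀ z → dist z ≤ n
  dist≤n z = least≤ (λ k → layer k z) n

  parent : ∀ {z} → A z → z ≢ v → ∃ λ p → A p × Edge G z p × dist p < dist z
  parent {z} z∈A z≢v with dist z in dz | least-sat (λ k → layer k z) n (to A⇔layer z∈A) ≤-refl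
  ... | zero | z∈layer0 with z ≟ v
  ...   | yes z≡v = ⊥-elim (z≢v z≡v)
  parent {z} z∈A z≢v | suc k | z∈layer with grow-elim (layer k) z z∈layer
  ... | inj₁ z∈layerk = ⊥-elim (<-irrefl refl (subst (_≤ k) dz (least-min (λ k → layer k z) n z∈layerk)))
  ... | inj₂ (_ , p , p∈layerk , pz) =
    p , from A⇔layer (saturated k p p∈layerk) , edge-sym G pz ,
    s≤s (least-min (λ k → layer k p) n p∈layerk)

module Recolouring {n} (G : Graph n) (c : ℕ) (D : EdgeSubset G) (adm : AdmissibleD G c D)
  (A : Fin n → Set) (component : IsPeripheryComponent G D A)
  (v : Fin n) (v∈A : A v) (small-v : deg G v < ⌊ c /2⌋ + 1)
  (L : Labeling G c) (L-STC : IsSTC L)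
  (L-weak : ∀ u w → Edge G u w → InEA A u w → lab L u w ≡ nothing) where

  open Distance G D A component v v∈A

  m : ℕ
  m = ⌊ c /2⌋

  deg≤1+m : ∀ {z} → A z → deg G z ≤ suc m
  deg≤1+m {z} z∈A = ≤-trans (periphery-deg G D (A⊆periphery z∈A))
    (subst (degMinus G D z ≤_) (+-comm m 1) (adm z))

  deg-v≤m : deg G v ≤ m
  deg-v≤m = m<1+n⇒m≤n (subst (deg G v <_) (+-comm m 1) small-v)

  m+m≤c : m + m ≤ c
  m+m≤c = begin
    m + m           ≤⟨ +-monoʳ-≤ m (⌊n/2⌋≤⌈n/2⌉ c) ⟩
    m + ⌈ c /2⌉     ≡⟨ ⌊n/2⌋+⌈n/2⌉≡n c ⟩
    c               ∎
    where open ≤-Reasoning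

  level : Fin n → Fin n → ℕ
  level u w = dist u ⊓ dist w

  record Invariant (t : ℕ) (M : Labeling G c) : Set where
    field
      stc        : IsSTC M
      agrees     : ∀ u w → Edge G u w → ¬ InEA A u w → lab M u w ≡ lab L u w
      weak-below : ∀ u w → Edge G u w → InEA A u w → level u w < t → lab M u w ≡ nothing
  open Invariant

  ColouredFrom : ℕ → Labeling G c → Set
  ColouredFrom t M = ∀ u w → Edge G u w → InEA A u w → t ≤ level u w → lab M u w ≢ nothing

  Extends : Labeling G c → Labeling G c → Set
  Extends M M' = ∀ u w → lab M u w ≢ nothing → lab M' u w ≢ nothing

  just≢nothing : ∀ {i : Fin c} → just i ≢ nothing
  just≢nothing ()

  -- The nearer end z of an edge zo on level t sees fewer than
  -- ⌊c/2⌋ colours: either z = v, or z's parent edge lies below level t.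
  near-end-bound : ∀ {t M z o} → Invariant t M → Edge G z o → A z →
    dist z ≤ dist o → dist z ≡ t → suc (length (seen M z o)) ≤ m
  near-end-bound {t} {M} {z} {o} inv zo z∈A z≤o z-on-t with z ≟ v
  ... | yes refl = begin
    suc (length (seen M v o)) ≤⟨ s≤s (seen-length≤ M v o) ⟩
    suc (degExcept G v o)     ≤⟨ degExcept<deg G zo ⟩
    deg G v                   ≤⟨ deg-v≤m ⟩
    m                         ∎
    where open ≤-Reasoning
  ... | no z≢v with parent z∈A z≢v
  ...   | p , p∈A , zp , p<z = ≤-pred (begin
    suc (suc (length (seen M z o))) ≤⟨ s≤s (seen-length< M zp p≢o parent-edge-weak) ⟩
    suc (degExcept G z o)           ≤⟨ degExcept<deg G zo ⟩
    deg G z                         ≤⟨ deg≤1+m z∈A ⟩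
    suc m                           ∎)
    where
    open ≤-Reasoning
    p≢o : p ≢ o
    p≢o refl = <-irrefl refl (<-≤-trans p<z z≤o)
    parent-edge-weak : lab M z p ≡ nothing
    parent-edge-weak = weak-below inv z p zp (z∈A , p∈A)
      (≤-<-trans (m⊓n≤n (dist z) (dist p)) (subst (dist p <_) z-on-t p<z))

  far-end-bound : ∀ {M : Labeling G c} {z o} → Edge G o z → A o → length (seen M o z) ≤ m
  far-end-bound {M} {z} {o} oz o∈A = ≤-pred (begin
    suc (length (seen M o z)) ≤⟨ s≤s (seen-length≤ M o z) ⟩
    suc (degExcept G o z)     ≤⟨ degExcept<deg G oz ⟩
    deg G o                   ≤⟨ deg≤1+m o∈A ⟩
    suc m                     ∎)
    where open ≤-Reasoning

  -- Colouring one edge zo of level t, with z the nearer end,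
  -- keeps the invariant: zo is the only edge that changes and lies in E(A)
  -- on level t.
  colour-oriented : ∀ {t M z o} → Invariant t M → Edge G z o → A z → A o →
    dist z ≤ dist o → dist z ≡ t →
    ∃ λ M' → Invariant t M' × Extends M M' × lab M' z o ≢ nothing
  colour-oriented {t} {M} {z} {o} inv zo z∈A o∈A z≤o z-on-t =
    relabel M z o i , inv' , extends , coloured
    where
    few : length (seen M z o) + length (seen M o z) < c
    few = ≤-trans (+-mono-≤ (near-end-bound inv zo z∈A z≤o z-on-t)
                            (far-end-bound {M} (edge-sym G zo) o∈A)) m+m≤c
    i = proj₁ (colour-edge M (stc inv) z o few)
    on-level-t : ∀ {u w} → Endpoints z o u w → level u w ≡ t
    on-level-t (inj₁ (refl , refl)) = trans (m≤n⇒m⊓n≡m z≤o) z-on-t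
    on-level-t (inj₂ (refl , refl)) = trans (m≥n⇒m⊓n≡n z≤o) z-on-t
    in-EA : ∀ {u w} → Endpoints z o u w → InEA A u w
    in-EA (inj₁ (refl , refl)) = z∈A , o∈A
    in-EA (inj₂ (refl , refl)) = o∈A , z∈A
    inv' : Invariant t (relabel M z o i)
    inv' .stc = proj₂ (colour-edge M (stc inv) z o few)
    inv' .agrees u w uw ∉EA =
      trans (relabel-off M z o i (∉EA ∘ in-EA)) (agrees inv u w uw ∉EA)
    inv' .weak-below u w uw ∈EA below =
      trans (relabel-off M z o i (λ e → <-irrefl (on-level-t e) below)) (weak-below inv u w uw ∈EA below)
    extends : Extends M (relabel M z o i)
    extends u w coloured-uw with relabel-cases M z o i u w
    ... | inj₁ new = subst (_≢ nothing) (sym new) just≢nothing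
    ... | inj₂ old = subst (_≢ nothing) (sym old) coloured-uw
    coloured : lab (relabel M z o i) z o ≢ nothing
    coloured = subst (_≢ nothing) (sym (relabel-on M z o i (inj₁ (refl , refl)))) just≢nothing

  colour-on-level : ∀ {t M x y} → Invariant t M → Edge G x y → InEA A x y → level x y ≡ t →
    ∃ λ M' → Invariant t M' × Extends M M' × lab M' x y ≢ nothing
  colour-on-level {t} {M} {x} {y} inv xy (x∈A , y∈A) on-t with ≤-total (dist x) (dist y)
  ... | inj₁ x≤y = colour-oriented inv xy x∈A y∈A x≤y (trans (sym (m≤n⇒m⊓n≡m x≤y)) on-t)
  ... | inj₂ y≤x with colour-oriented inv (edge-sym G xy) y∈A x∈A y≤x (trans (sym (m≥n⇒m⊓n≡n y≤x)) on-t)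
  ...   | M' , inv' , ext , yx-coloured = M' , inv' , ext , yx-coloured ∘ trans (labSym M' y x (edge-sym G xy))

  ColouredAt : ℕ → Labeling G c → Fin n → Fin n → Set
  ColouredAt t M x y = Edge G x y → InEA A x y → level x y ≡ t → lab M x y ≢ nothing

  colour-pair : ∀ {t M} → Invariant t M → ∀ x y →
    ∃ λ M' → Invariant t M' × Extends M M' × ColouredAt t M' x y
  colour-pair {t} {M} inv x y with adj G x y ≡? true ×-dec A? x ×-dec A? y ×-dec level x y ≟ℕ t
  ... | yes (xy , x∈A , y∈A , on-t) with colour-on-level inv xy (x∈A , y∈A) on-t
  ...   | M' , inv' , ext , xy-coloured = M' , inv' , ext , λ _ _ _ → xy-coloured
  colour-pair {t} {M} inv x y | no irrelevant =
    M , inv , (λ _ _ → id) , λ xy (x∈A , y∈A) on-t → ⊥-elim (irrelevant (xy , x∈A , y∈A , on-t))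

  colour-pairs : ∀ {t M} → Invariant t M → (ps : List (Fin n × Fin n)) →
    ∃ λ M' → Invariant t M' × Extends M M' × (∀ {x y} → (x , y) ∈ ps → ColouredAt t M' x y)
  colour-pairs inv [] = _ , inv , (λ _ _ → id) , λ ()
  colour-pairs inv ((x , y) ∷ ps) with colour-pair inv x y
  ... | M₁ , inv₁ , ext₁ , xy-coloured with colour-pairs inv₁ ps
  ...   | M₂ , inv₂ , ext₂ , ps-coloured =
    M₂ , inv₂ , (λ u w → ext₂ u w ∘ ext₁ u w) , coloured
    where
    coloured : ∀ {u w} → (u , w) ∈ ((x , y) ∷ ps) → ColouredAt _ M₂ u w
    coloured (here refl) uw ∈EA on-t = ext₂ x y (xy-coloured uw ∈EA on-t)
    coloured (there uw∈ps) = ps-coloured uw∈ps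

  colour-level : ∀ {t M} → Invariant (suc t) M → ColouredFrom (suc t) M →
    ∃ λ M' → Invariant t M' × ColouredFrom t M'
  colour-level {t} {M} inv above with colour-pairs (lower inv) (cartesianProduct (allFin n) (allFin n))
    where
    lower : Invariant (suc t) M → Invariant t M
    lower inv = record { stc = stc inv ; agrees = agrees inv
                       ; weak-below = λ u w uw ∈EA below → weak-below inv u w uw ∈EA (m≤n⇒m≤1+n below) }
  ... | M' , inv' , ext , level-t-coloured = M' , inv' , coloured
    where
    coloured : ColouredFrom t M'
    coloured u w uw ∈EA t≤level with level u w ≟ℕ t
    ... | yes on-t = level-t-coloured (∈-cartesianProduct⁺ (∈-allFin u) (∈-allFin w)) uw ∈EA on-t
    ... | no off-t = ext u w (above u w uw ∈EA (≤∧≢⇒< t≤level (off-t ∘ sym)))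

  descend : ∀ t {M} → Invariant t M → ColouredFrom t M →
    ∃ λ M' → Invariant 0 M' × ColouredFrom 0 M'
  descend zero inv coloured = _ , inv , coloured
  descend (suc t) inv coloured with colour-level inv coloured
  ... | M' , inv' , coloured' = descend t inv' coloured'

  start : Invariant (suc n) L
  start = record { stc = L-STC ; agrees = λ _ _ _ _ → refl
                 ; weak-below = λ u w uw ∈EA _ → L-weak u w uw ∈EA }

  nothing-above-n : ColouredFrom (suc n) L
  nothing-above-n u w _ _ n<level = ⊥-elim (<-irrefl refl
    (≤-trans n<level (≤-trans (m⊓n≤m (dist u) (dist w)) (dist≤n u))))

  good : Σ (Labeling G c) λ L' → IsSTC L' × PartiallyEqualOutside A L L' ×
           (∀ u w → Edge G u w → InEA A u w → lab L' u w ≢ nothing)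
  good with descend (suc n) start nothing-above-n
  ... | L' , inv , coloured =
    L' , stc inv , (λ u w uw ∉EA → sym (agrees inv u w uw ∉EA)) , λ u w uw ∈EA → coloured u w uw ∈EA z≤n

proposition24 : ∀ {n : ℕ} (G : Graph n) (c k : ℕ) (D : EdgeSubset G) →
    AdmissibleD G c D →
    (A : Fin n → Set) → IsPeripheryComponent G D A →
    Σ (Fin n) (λ v → A v × deg G v < ⌊ c /2⌋ + 1) →
    Good G c A
proposition24 G c _ D adm A component (v , v∈A , small-v) L L-STC L-weak =
  Recolouring.good G c D adm A component v v∈A small-v L L-STC L-weak
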